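{- Let $m\geq 3$ be an integer and, for $n\geq 1$, let $S_n(m)=\frac{n}{2}\big[(m-2)n-m+4\big]$ be the $n$-th $m$-gonal figurate number. For $n\geq 3$ define $$R(n)=\frac{m+2(n-2)(m-2)}{1+(n-2)(m-2)},\qquad T(n)=-\frac{m-1+(n-2)(m-2)}{1+(n-2)(m-2)}.$$ Then for all $n\geq 3$, $$S_n(m)=R(n)S_{n-1}(m)+T(n)S_{n-2}(m),$$ with $S_1(m)=1$, $S_2(m)=m$. Moreover, letting $x_k=\frac{S_{k+1}(m)}{S_k(m)}$ for $k\geq 1$, one has $x_1=m$ and, for all $n\geq 3$, $$x_{n-1}=R(n)+\frac{T(n)}{x_{n-2}}.$$
   Context: The $n$-th $m$-gonal figurate number $S_n(m)$ is the sum of the first $n$ terms of the arithmetic progression $1,1+(m-2),1+2(m-2),\dots$, which equals $\frac{n}{2}\big[(m-2)n-m+4\big]$. -}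

module Defs where

open import Data.Nat as ℕ using (ℕ; suc; _∸_)
open import Data.Integer as ℤ using (ℤ; +_)
open import Data.Rational as ℚ using (ℚ; 0ℚ; _÷_; _≟_)
open import Relation.Nullary using (yes; no)

-- Total division on ℚ: p ÷' q = p / q when q ≠ 0 (and 0 when q = 0;
-- this branch is never used in the theorem since S_k(m) ≠ 0 for k ≥ 1, m ≥ 3).
_÷'_ : ℚ → ℚ → ℚ
p ÷' q with q ≟ 0ℚ
... | yes _ = 0ℚ
... | no q≢0 = _÷_ p q {{ℚ.≢-nonZero q≢0}}

S : ℕ → ℕ → ℚ
S n m = ((+ n) ℤ.* (((+ m) ℤ.- + 2) ℤ.* (+ n) ℤ.- (+ m) ℤ.+ + 4)) ℚ./ 2

-- common denominator 1 + (n-2)(m-2)   (used for n ≥ 3, m ≥ 3, so ∸ is exact)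
den : ℕ → ℕ → ℕ
den n m = suc ((n ∸ 2) ℕ.* (m ∸ 2))

R : ℕ → ℕ → ℚ
R n m = (+ (m ℕ.+ 2 ℕ.* (n ∸ 2) ℕ.* (m ∸ 2))) ℚ./ den n m

T : ℕ → ℕ → ℚ
T n m = (ℤ.- (+ ((m ∸ 1) ℕ.+ (n ∸ 2) ℕ.* (m ∸ 2)))) ℚ./ den n m

x : ℕ → ℕ → ℚ
x k m = S (suc k) m ÷' S k m

-- Clearing the common denominator 1 + (n-2)(m-2), the recurrence for S_n(m) becomes a
-- polynomial identity between the integers 2 S_k(m), settled by the ring solver. Since
-- S_k(m) ≠ 0 for k ≥ 1, dividing the recurrence by S_{n-1}(m) and writing
-- S_{n-2}(m)/S_{n-1}(m) = 1/x_{n-2} gives the recurrence for x.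
module Submission where

open import Defs
open import Data.Nat using (ℕ; _≥_; _∸_)
open import Data.Rational using (ℚ; _+_; _*_; 1ℚ; _/_)
open import Data.Integer using (+_)
open import Data.Product using (_×_)
open import Relation.Binary.PropositionalEquality using (_≡_)

open import Data.Nat as ℕ using (suc; s≤s)
open import Data.Integer as ℤ using (ℤ; 0ℤ)
import Data.Integer.Properties as ℤP
open import Data.Integer.Tactic.RingSolver using (solve-∀)
open import Data.Rational as ℚ using (0ℚ; 1/_; _≟_; toℚᵘ)
open import Data.Rational.Properties
  using (toℚᵘ-injective; toℚᵘ-fromℚᵘ; fromℚᵘ-cong; toℚᵘ-cong; toℚᵘ-homo-+; toℚᵘ-homo-*;
         *-assoc; *-inverseˡ; *-inverseʳ; *-identityʳ; *-zeroˡ; *-distribʳ-+)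
open import Data.Rational.Unnormalised as ℚᵘ using (mkℚᵘ; *≡*)
import Data.Rational.Unnormalised.Properties as ℚᵘ
open import Data.Product using (_,_)
open import Data.Empty using (⊥-elim)
open import Function using (case_of_)
open import Relation.Nullary using (¬_; yes; no)
open import Relation.Binary.PropositionalEquality using (sym; trans; cong; module ≡-Reasoning)

p÷'q*q≡p : ∀ p {q} → ¬ q ≡ 0ℚ → (p ÷' q) * q ≡ p
p÷'q*q≡p p {q} q≢0 with q ≟ 0ℚ
... | yes q≡0 = ⊥-elim (q≢0 q≡0)
... | no q≢0' = begin
  p * 1/ q * q   ≡⟨ *-assoc p (1/ q) q ⟩
  p * (1/ q * q) ≡⟨ cong (p *_) (*-inverseˡ q) ⟩
  p * 1ℚ         ≡⟨ *-identityʳ p ⟩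
  p              ∎
  where
  open ≡-Reasoning
  instance _ = ℚ.≢-nonZero q≢0'

÷'-unique : ∀ {p q u} → ¬ q ≡ 0ℚ → u * q ≡ p → p ÷' q ≡ u
÷'-unique {p} {q} {u} q≢0 uq≡p with q ≟ 0ℚ
... | yes q≡0 = ⊥-elim (q≢0 q≡0)
... | no q≢0' = begin
  p * 1/ q       ≡⟨ cong (_* 1/ q) (sym uq≡p) ⟩
  u * q * 1/ q   ≡⟨ *-assoc u q (1/ q) ⟩
  u * (q * 1/ q) ≡⟨ cong (u *_) (*-inverseʳ q) ⟩
  u * 1ℚ         ≡⟨ *-identityʳ u ⟩
  u              ∎
  where
  open ≡-Reasoning
  instance _ = ℚ.≢-nonZero q≢0'

÷'-≢0 : ∀ {p q} → ¬ p ≡ 0ℚ → ¬ q ≡ 0ℚ → ¬ p ÷' q ≡ 0ℚ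
÷'-≢0 {p} {q} p≢0 q≢0 p÷'q≡0 = p≢0 (begin
  p            ≡⟨ sym (p÷'q*q≡p p q≢0) ⟩
  (p ÷' q) * q ≡⟨ cong (_* q) p÷'q≡0 ⟩
  0ℚ * q       ≡⟨ *-zeroˡ q ⟩
  0ℚ           ∎)
  where open ≡-Reasoning

÷'-continuedFraction : ∀ r t {a b c} → ¬ b ≡ 0ℚ → ¬ c ≡ 0ℚ →
  a ≡ r * b + t * c → a ÷' b ≡ r + (t ÷' (b ÷' c))
÷'-continuedFraction r t {a} {b} {c} b≢0 c≢0 a≡rb+tc =
  ÷'-unique b≢0 (begin
    (r + w) * b         ≡⟨ *-distribʳ-+ b r w ⟩
    r * b + w * b       ≡⟨ cong (λ z → r * b + w * z) (sym (p÷'q*q≡p b c≢0)) ⟩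
    r * b + w * (v * c) ≡⟨ cong (λ z → r * b + z) (sym (*-assoc w v c)) ⟩
    r * b + w * v * c   ≡⟨ cong (λ z → r * b + z * c) (p÷'q*q≡p t (÷'-≢0 b≢0 c≢0)) ⟩
    r * b + t * c       ≡⟨ sym a≡rb+tc ⟩
    a                   ∎)
  where
  open ≡-Reasoning
  v = b ÷' c
  w = t ÷' v

linearCombination-crossMultiplied : ∀ D E s x y → D ℤ.* s ≡ x ℤ.+ y →
  s ℤ.* ((D ℤ.* E) ℤ.* (D ℤ.* E)) ≡ (x ℤ.* (D ℤ.* E) ℤ.+ y ℤ.* (D ℤ.* E)) ℤ.* E
linearCombination-crossMultiplied D E s x y Ds≡x+y = begin
  s ℤ.* ((D ℤ.* E) ℤ.* (D ℤ.* E))             ≡⟨ regroup D E s ⟩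
  (D ℤ.* s) ℤ.* (D ℤ.* E) ℤ.* E               ≡⟨ cong (λ z → z ℤ.* (D ℤ.* E) ℤ.* E) Ds≡x+y ⟩
  (x ℤ.+ y) ℤ.* (D ℤ.* E) ℤ.* E               ≡⟨ distrib D E x y ⟩
  (x ℤ.* (D ℤ.* E) ℤ.+ y ℤ.* (D ℤ.* E)) ℤ.* E ∎
  where
  open ≡-Reasoning
  regroup : ∀ D E s → s ℤ.* ((D ℤ.* E) ℤ.* (D ℤ.* E)) ≡ (D ℤ.* s) ℤ.* (D ℤ.* E) ℤ.* E
  regroup = solve-∀
  distrib : ∀ D E x y → (x ℤ.+ y) ℤ.* (D ℤ.* E) ℤ.* E ≡ (x ℤ.* (D ℤ.* E) ℤ.+ y ℤ.* (D ℤ.* E)) ℤ.* E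
  distrib = solve-∀

/-≡ : ∀ p q d e → p ℤ.* + suc e ≡ q ℤ.* + suc d → p / suc d ≡ q / suc e
/-≡ p q d e eq = fromℚᵘ-cong {mkℚᵘ p d} {mkℚᵘ q e} (*≡* eq)

/-≢0 : ∀ p d → ¬ p ≡ 0ℤ → ¬ p / suc d ≡ 0ℚ
/-≢0 p d p≢0 p/d≡0 with ℚᵘ.≃-trans (ℚᵘ.≃-sym (toℚᵘ-fromℚᵘ (mkℚᵘ p d))) (toℚᵘ-cong p/d≡0)
... | *≡* p*1≡0 = p≢0 (trans (sym (ℤP.*-identityʳ p)) p*1≡0)

/-linearCombination : ∀ (a b s s₁ s₂ : ℤ) d e →
  + suc d ℤ.* s ≡ a ℤ.* s₁ ℤ.+ b ℤ.* s₂ →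
  s / suc e ≡ a / suc d * (s₁ / suc e) + b / suc d * (s₂ / suc e)
/-linearCombination a b s s₁ s₂ d e eq = toℚᵘ-injective (begin
  toℚᵘ (s / suc e)
    ≈⟨ fraction s e ⟩
  mkℚᵘ s e
    ≈⟨ *≡* (linearCombination-crossMultiplied (+ suc d) (+ suc e) s (a ℤ.* s₁) (b ℤ.* s₂) eq) ⟩
  mkℚᵘ a d ℚᵘ.* mkℚᵘ s₁ e ℚᵘ.+ mkℚᵘ b d ℚᵘ.* mkℚᵘ s₂ e
    ≈⟨ ℚᵘ.≃-sym (ℚᵘ.+-cong (ℚᵘ.*-cong (fraction a d) (fraction s₁ e))
                          (ℚᵘ.*-cong (fraction b d) (fraction s₂ e))) ⟩
  toℚᵘ (a / suc d) ℚᵘ.* toℚᵘ (s₁ / suc e) ℚᵘ.+ toℚᵘ (b / suc d) ℚᵘ.* toℚᵘ (s₂ / suc e)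
    ≈⟨ ℚᵘ.≃-sym (ℚᵘ.+-cong (toℚᵘ-homo-* (a / suc d) (s₁ / suc e))
                          (toℚᵘ-homo-* (b / suc d) (s₂ / suc e))) ⟩
  toℚᵘ (a / suc d * (s₁ / suc e)) ℚᵘ.+ toℚᵘ (b / suc d * (s₂ / suc e))
    ≈⟨ ℚᵘ.≃-sym (toℚᵘ-homo-+ (a / suc d * (s₁ / suc e)) (b / suc d * (s₂ / suc e))) ⟩
  toℚᵘ (a / suc d * (s₁ / suc e) + b / suc d * (s₂ / suc e)) ∎)
  where
  open ℚᵘ.≃-Reasoning
  fraction : ∀ p d → toℚᵘ (p / suc d) ℚᵘ.≃ mkℚᵘ p d
  fraction p d = toℚᵘ-fromℚᵘ (mkℚᵘ p d)

-- S n m is definitionally doubleS n m / 2.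
doubleS : ℕ → ℕ → ℤ
doubleS n m = + n ℤ.* ((+ m ℤ.- + 2) ℤ.* + n ℤ.- + m ℤ.+ + 4)

-- Stated for n = 3 + k and m = 3 + j, so that the truncated subtractions in R and T compute.
doubleS-recurrence : ∀ k j → let n = 3 ℕ.+ k ; m = 3 ℕ.+ j in
  + den n m ℤ.* doubleS n m ≡
  + (m ℕ.+ 2 ℕ.* (n ∸ 2) ℕ.* (m ∸ 2)) ℤ.* doubleS (n ∸ 1) m
    ℤ.+ ℤ.- + ((m ∸ 1) ℕ.+ (n ∸ 2) ℕ.* (m ∸ 2)) ℤ.* doubleS (n ∸ 2) m
doubleS-recurrence k j = polynomial (+ k) (+ j)
  where
  polynomial : ∀ K J → let m = + 3 ℤ.+ J ; s = λ n → n ℤ.* ((m ℤ.- + 2) ℤ.* n ℤ.- m ℤ.+ + 4) in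
    (+ 1 ℤ.+ (+ 1 ℤ.+ K) ℤ.* (+ 1 ℤ.+ J)) ℤ.* s (+ 3 ℤ.+ K) ≡
    (m ℤ.+ + 2 ℤ.* (+ 1 ℤ.+ K) ℤ.* (+ 1 ℤ.+ J)) ℤ.* s (+ 2 ℤ.+ K)
      ℤ.+ ℤ.- (+ 2 ℤ.+ J ℤ.+ (+ 1 ℤ.+ K) ℤ.* (+ 1 ℤ.+ J)) ℤ.* s (+ 1 ℤ.+ K)
  polynomial = solve-∀

S-1 : ∀ m → S 1 m ≡ 1ℚ
S-1 m = /-≡ (doubleS 1 m) (+ 1) 1 0 (polynomial (+ m))
  where
  polynomial : ∀ M → + 1 ℤ.* ((M ℤ.- + 2) ℤ.* + 1 ℤ.- M ℤ.+ + 4) ℤ.* + 1 ≡ + 1 ℤ.* + 2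
  polynomial = solve-∀

S-2 : ∀ m → S 2 m ≡ + m / 1
S-2 m = /-≡ (doubleS 2 m) (+ m) 1 0 (polynomial (+ m))
  where
  polynomial : ∀ M → + 2 ℤ.* ((M ℤ.- + 2) ℤ.* + 2 ℤ.- M ℤ.+ + 4) ℤ.* + 1 ≡ M ℤ.* + 2
  polynomial = solve-∀

doubleS-suc : ∀ k i → doubleS (suc k) (2 ℕ.+ i) ≡ + (suc k ℕ.* (2 ℕ.+ i ℕ.* k))
doubleS-suc k i = begin
  doubleS (suc k) (2 ℕ.+ i)             ≡⟨ polynomial (+ k) (+ i) ⟩
  + suc k ℤ.* (+ 2 ℤ.+ + i ℤ.* + k)     ≡⟨ cong (λ z → + suc k ℤ.* (+ 2 ℤ.+ z)) (sym (ℤP.pos-* i k)) ⟩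
  + suc k ℤ.* (+ 2 ℤ.+ + (i ℕ.* k))     ≡⟨ cong (+ suc k ℤ.*_) (sym (ℤP.pos-+ 2 (i ℕ.* k))) ⟩
  + suc k ℤ.* + (2 ℕ.+ i ℕ.* k)         ≡⟨ sym (ℤP.pos-* (suc k) (2 ℕ.+ i ℕ.* k)) ⟩
  + (suc k ℕ.* (2 ℕ.+ i ℕ.* k))         ∎
  where
  open ≡-Reasoning
  polynomial : ∀ K I → let m = + 2 ℤ.+ I ; n = + 1 ℤ.+ K in
    n ℤ.* ((m ℤ.- + 2) ℤ.* n ℤ.- m ℤ.+ + 4) ≡ n ℤ.* (+ 2 ℤ.+ I ℤ.* K)
  polynomial = solve-∀

S-≢0 : ∀ k i → ¬ S (suc k) (2 ℕ.+ i) ≡ 0ℚ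
S-≢0 k i = /-≢0 (doubleS (suc k) (2 ℕ.+ i)) 1
  (λ doubleS≡0 → case trans (sym (doubleS-suc k i)) doubleS≡0 of λ ())

S-recurrence : ∀ k j → let n = 3 ℕ.+ k ; m = 3 ℕ.+ j in
  S n m ≡ R n m * S (n ∸ 1) m + T n m * S (n ∸ 2) m
S-recurrence k j =
  /-linearCombination (+ (m ℕ.+ 2 ℕ.* (n ∸ 2) ℕ.* (m ∸ 2))) (ℤ.- + ((m ∸ 1) ℕ.+ (n ∸ 2) ℕ.* (m ∸ 2)))
    (doubleS n m) (doubleS (n ∸ 1) m) (doubleS (n ∸ 2) m) ((n ∸ 2) ℕ.* (m ∸ 2)) 1
    (doubleS-recurrence k j)
  where
  n = 3 ℕ.+ k
  m = 3 ℕ.+ j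

x-1 : ∀ m → x 1 m ≡ + m / 1
x-1 m = ÷'-unique S₁≢0 (begin
  + m / 1 * S 1 m ≡⟨ cong (+ m / 1 *_) (S-1 m) ⟩
  + m / 1 * 1ℚ    ≡⟨ *-identityʳ (+ m / 1) ⟩
  + m / 1         ≡⟨ S-2 m ⟨
  S 2 m           ∎)
  where
  open ≡-Reasoning
  S₁≢0 : ¬ S 1 m ≡ 0ℚ
  S₁≢0 S₁≡0 = case trans (sym (S-1 m)) S₁≡0 of λ ()

x-recurrence : ∀ k j → let n = 3 ℕ.+ k ; m = 3 ℕ.+ j in
  x (n ∸ 1) m ≡ R n m + (T n m ÷' x (n ∸ 2) m)
x-recurrence k j = ÷'-continuedFraction (R (3 ℕ.+ k) (3 ℕ.+ j)) (T (3 ℕ.+ k) (3 ℕ.+ j))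
  (S-≢0 (suc k) (suc j)) (S-≢0 k (suc j)) (S-recurrence k j)

mainTheorem2 : (m : ℕ) → m ≥ 3 →
    ((n : ℕ) → n ≥ 3 → S n m ≡ R n m * S (n ∸ 1) m + T n m * S (n ∸ 2) m)
    × S 1 m ≡ 1ℚ
    × S 2 m ≡ ((+ m) / 1)
    × x 1 m ≡ ((+ m) / 1)
    × ((n : ℕ) → n ≥ 3 → x (n ∸ 1) m ≡ R n m + (T n m ÷' x (n ∸ 2) m))
mainTheorem2 m@(suc (suc (suc j))) (s≤s (s≤s (s≤s _))) =
  (λ { (suc (suc (suc k))) (s≤s (s≤s (s≤s _))) → S-recurrence k j })
  , S-1 m
  , S-2 m
  , x-1 m
  , λ { (suc (suc (suc k))) (s≤s (s≤s (s≤s _))) → x-recurrence k j }
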